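{- There is an absolute constant $C$ such that for every string $T$ (as in the context) with run-length encoding size $m$, $|\mathcal{M}_5(T)|\le C\,m$; i.e. $|\mathcal{M}_5|\in O(m)$.
   Context: $\Sigma$ is an ordered alphabet, $\$\notin\Sigma$, and $T$ is a string of length $n\ge3$ with $T[1]=T[n]=\$$ and $T[2..n-1]\in\Sigma^*$; $m$ is the number of maximal runs of equal characters in $T[2..n-1]$. For a string $w$, $R(w)$ denotes the number of maximal runs of equal characters in $w$. A string $w\in\Sigma^*$ is a minimal absent word (MAW) for $T$ if $w$ does not occur in $T$ but every proper substring of $w$ occurs in $T$. Write a MAW of length at least 2 as $aub$ with $a,b\in\Sigma$, $u\in\Sigma^*$. $\mathcal{M}_5(T)$ is the set of MAWs $aub$ with $R(aub)\ge2$ and ($a=u[1]$ or $b=u[|u|]$). -}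

module Defs where

open import Level using (0ℓ)
open import Data.Nat using (ℕ; zero; suc; _≤_)
open import Data.Maybe using (Maybe; just; nothing)
open import Data.List using (List; []; _∷_; _++_; map; head; last; length)
open import Data.Product using (Σ; ∃; ∃-syntax; _×_)
open import Data.Sum using (_⊎_)
open import Relation.Nullary using (¬_; yes; no)
open import Relation.Binary.PropositionalEquality using (_≡_; _≢_)
open import Relation.Binary.Core using (Rel)
open import Relation.Binary.Structures using (IsStrictTotalOrder)

module Strings {Carrier : Set} {_<_ : Rel Carrier 0ℓ}
               (sto : IsStrictTotalOrder _≡_ _<_) where
  open IsStrictTotalOrder sto using (_≟_)

  -- Letters of T: nothing plays the role of the sentinel $ ∉ Σ.
  Letter : Set
  Letter = Maybe Carrier

  mkT : List Carrier → List Letter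
  mkT S = nothing ∷ map just S ++ nothing ∷ []

  _⊑_ : {A : Set} → List A → List A → Set
  v ⊑ w = ∃[ x ] ∃[ y ] (x ++ v ++ y ≡ w)

  OccursIn : List Carrier → List Letter → Set
  OccursIn w t = map just w ⊑ t

  IsMAW : List Carrier → List Letter → Set
  IsMAW w t = ¬ OccursIn w t × (∀ v → v ⊑ w → v ≢ w → OccursIn v t)

  runs : List Carrier → ℕ

  runsFrom : Carrier → List Carrier → ℕ
  runsFrom x [] = 1
  runsFrom x (y ∷ r) with x ≟ y
  ... | yes _ = runsFrom y r
  ... | no _ = suc (runsFrom y r)

  runs [] = 0
  runs (x ∷ r) = runsFrom x r

  InM5 : List Carrier → List Carrier → Set
  InM5 S w = ∃[ a ] ∃[ u ] ∃[ b ]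
    ( w ≡ a ∷ u ++ b ∷ []
    × IsMAW w (mkT S)
    × 2 ≤ runs w
    × (head u ≡ just a ⊎ last u ≡ just b) )

-- A word a u b of M₅ starts with a doubled letter a a or ends with a doubled letter b b.  In the
-- first case its proper suffix occurs in S, and every occurrence of it starts at a run boundary,
-- for otherwise the preceding letter is a and the whole word would occur; symmetrically, in the
-- second case its proper prefix occurs ending at a run boundary.  Of two MAWs of the same kind
-- anchored at the same boundary one is a factor of the other, hence they are equal, since no MAW
-- is a proper factor of another.  A string with m ≥ 1 runs has m + 1 run boundaries, so |M₅| ≤ 2(m + 1) ≤ 4m.
module Submission where

open import Defs
open import Level using (0ℓ)
open import Function using (_∘_; case_of_)
open import Data.Nat using (ℕ; _≤_; _*_; _+_; suc; z≤n; s≤s)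
open import Data.Nat.Properties using (≤-trans; +-mono-≤; +-monoˡ-≤; module ≤-Reasoning)
open import Data.Nat.Tactic.RingSolver using (solve-∀)
open import Data.Maybe using (just; nothing)
open import Data.List using (List; []; _∷_; _++_; _∷ʳ_; map; head; last; length)
open import Data.List.Properties
  using (++-assoc; ++-identityʳ; ++-identityˡ-unique; ++-cancelˡ; ++-conicalʳ; ∷-injective;
         ∷-injectiveʳ; ∷ʳ-injective; ∷ʳ-injectiveʳ; ∷ʳ-++; map-++; length-map; length-++;
         length-removeAt′)
open import Data.List.Relation.Unary.All as All using (All; []; _∷_)
open import Data.List.Relation.Unary.Any as Any using (Any; here; there; _─_)
open import Data.List.Relation.Unary.Any.Properties using (map⁺; ++⁺ˡ; ++⁺ʳ)
open import Data.List.Relation.Unary.Unique.Propositional using (Unique; []; _∷_)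
open import Data.List.Membership.Propositional using (_∈_; lose)
open import Data.List.Membership.Propositional.Properties using (∈-map⁺)
open import Data.Product using (∃-syntax; _×_; _,_; proj₁; proj₂; map₁)
open import Data.Sum using (_⊎_; inj₁; inj₂; [_,_]′)
open import Data.Empty using (⊥)
open import Relation.Nullary using (¬_; yes; no; contradiction)
open import Relation.Binary.Core using (Rel)
open import Relation.Binary.Structures using (IsStrictTotalOrder)
open import Relation.Binary.PropositionalEquality
  using (_≡_; _≢_; refl; sym; trans; cong; cong₂; module ≡-Reasoning)

module _ {W T : Set} {R : W → T → Set} where

  Any-─⁺ : ∀ {w w' ts} (p : Any (R w) ts) → (∀ {t} → R w t → R w' t → ⊥) →
           Any (R w') ts → Any (R w') (ts ─ p)
  Any-─⁺ (here r)  disjoint (here r')  = contradiction r' (disjoint r)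
  Any-─⁺ (here _)  disjoint (there q)  = q
  Any-─⁺ (there _) disjoint (here r')  = here r'
  Any-─⁺ (there p) disjoint (there q)  = there (Any-─⁺ p disjoint q)

  pigeonhole : (∀ {w w' t} → w ≢ w' → R w t → R w' t → ⊥) →
               ∀ {ws} ts → Unique ws → All (λ w → Any (R w) ts) ws → length ws ≤ length ts
  pigeonhole disjoint ts [] [] = z≤n
  pigeonhole disjoint ts (w≢ws ∷ unique) (p ∷ ps) rewrite length-removeAt′ ts (Any.index p) =
    s≤s (pigeonhole disjoint (ts ─ p) unique
          (All.zipWith (λ (w≢w' , q) → Any-─⁺ p (disjoint w≢w') q) (w≢ws , ps)))

module _ {A : Set} where

  ++-prefixes-comparable : ∀ (v z v' z' : List A) → v ++ z ≡ v' ++ z' →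
                           (∃[ d ] v' ≡ v ++ d) ⊎ (∃[ d ] v ≡ v' ++ d)
  ++-prefixes-comparable []      z v'       z' eq = inj₁ (v' , refl)
  ++-prefixes-comparable (c ∷ v) z []       z' eq = inj₂ (c ∷ v , refl)
  ++-prefixes-comparable (c ∷ v) z (c' ∷ v') z' eq with ∷-injective eq
  ... | refl , eq' with ++-prefixes-comparable v z v' z' eq'
  ... | inj₁ (d , refl) = inj₁ (d , refl)
  ... | inj₂ (d , refl) = inj₂ (d , refl)

  ++-suffixes-comparable : ∀ (p v p' v' : List A) → p ++ v ≡ p' ++ v' →
                           (∃[ d ] v' ≡ d ++ v) ⊎ (∃[ d ] v ≡ d ++ v')
  ++-suffixes-comparable []      v p'       v' eq = inj₂ (p' , eq)
  ++-suffixes-comparable (c ∷ p) v []       v' eq = inj₁ (c ∷ p , sym eq)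
  ++-suffixes-comparable (c ∷ p) v (_ ∷ p') v' eq =
    ++-suffixes-comparable p v p' v' (∷-injectiveʳ eq)

  last≡just⇒∷ʳ : ∀ (u : List A) {b} → last u ≡ just b → ∃[ u₀ ] u ≡ u₀ ∷ʳ b
  last≡just⇒∷ʳ (c ∷ [])    refl = [] , refl
  last≡just⇒∷ʳ (c ∷ d ∷ u) eq with last≡just⇒∷ʳ (d ∷ u) eq
  ... | u₀ , eq' = c ∷ u₀ , cong (c ∷_) eq'

module MinimalAbsentWords {A : Set} {_<_ : Rel A 0ℓ} (sto : IsStrictTotalOrder _≡_ _<_) where
  open Strings sto
  open IsStrictTotalOrder sto using (_≟_)

  ⊑-map : ∀ {B C : Set} (f : B → C) {v w : List B} → v ⊑ w → map f v ⊑ map f w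
  ⊑-map f (x , y , refl) =
    map f x , map f y , sym (trans (map-++ f x _) (cong (map f x ++_) (map-++ f _ y)))

  ⊑-++ : ∀ {B : Set} (p q : List B) {v w : List B} → v ⊑ w → v ⊑ (p ++ w ++ q)
  ⊑-++ p q {v} (x , y , refl) = p ++ x , y ++ q , (begin
    (p ++ x) ++ v ++ y ++ q   ≡⟨ ++-assoc p x _ ⟩
    p ++ x ++ v ++ y ++ q     ≡⟨ cong (λ s → p ++ x ++ s) (++-assoc v y q) ⟨
    p ++ x ++ (v ++ y) ++ q   ≡⟨ cong (p ++_) (++-assoc x (v ++ y) q) ⟨
    p ++ (x ++ v ++ y) ++ q   ∎)
    where open ≡-Reasoning

  ⊑-++ˡ : ∀ {B : Set} (d v q : List B) → (v ++ q) ⊑ ((d ++ v) ++ q)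
  ⊑-++ˡ d v q = d , [] , trans (cong (d ++_) (++-identityʳ _)) (sym (++-assoc d v q))

  ⊑⇒OccursIn : ∀ {w S} → w ⊑ S → OccursIn w (mkT S)
  ⊑⇒OccursIn = ⊑-++ (nothing ∷ []) (nothing ∷ []) ∘ ⊑-map just

  private
    just-prefix : ∀ (v S : List A) {Y} → map just v ++ Y ≡ map just S ++ nothing ∷ [] →
                  ∃[ z ] v ++ z ≡ S
    just-prefix []      S       eq = S , refl
    just-prefix (c ∷ v) (d ∷ S) eq with ∷-injective eq
    ... | refl , eq' with just-prefix v S eq'
    ... | z , refl = z , refl

    just-infix : ∀ (X : List Letter) c (v S : List A) {Y} →
                 X ++ map just (c ∷ v) ++ Y ≡ map just S ++ nothing ∷ [] → (c ∷ v) ⊑ S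
    just-infix []          c v S       eq = [] , just-prefix (c ∷ v) S eq
    just-infix (_ ∷ X)     c v (d ∷ S) eq with just-infix X c v S (∷-injectiveʳ eq)
    ... | x , z , eq' = d ∷ x , z , cong (d ∷_) eq'
    just-infix (_ ∷ [])    c v []      ()
    just-infix (_ ∷ _ ∷ _) c v []      ()

  OccursIn⇒⊑ : ∀ {w S} → w ≢ [] → OccursIn w (mkT S) → w ⊑ S
  OccursIn⇒⊑ {[]}    w≢[] _                 = contradiction refl w≢[]
  OccursIn⇒⊑ {c ∷ w} _    (_ ∷ X , Y , eq)  = just-infix X c w _ (∷-injectiveʳ eq)

  ⊑-comparable-MAWs : ∀ {w w' t} → IsMAW w t → IsMAW w' t → w ⊑ w' ⊎ w' ⊑ w → w ≢ w' → ⊥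
  ⊑-comparable-MAWs m m' (inj₁ w⊑w') w≢w' = proj₁ m (proj₂ m' _ w⊑w' w≢w')
  ⊑-comparable-MAWs m m' (inj₂ w'⊑w) w≢w' = proj₁ m' (proj₂ m _ w'⊑w (w≢w' ∘ sym))

  Split : Set
  Split = List A × List A

  RunBoundary : List A → List A → Set
  RunBoundary x y = ∀ x₀ d → x ≡ x₀ ∷ʳ d → head y ≢ just d

  boundariesAfter : A → List A → List Split
  boundariesAfter c []      = ([] , []) ∷ []
  boundariesAfter c (d ∷ r) with c ≟ d
  ... | yes _ = map (map₁ (d ∷_)) (boundariesAfter d r)
  ... | no _  = ([] , d ∷ r) ∷ map (map₁ (d ∷_)) (boundariesAfter d r)

  boundaries : List A → List Split
  boundaries []      = ([] , []) ∷ []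
  boundaries (c ∷ r) = ([] , c ∷ r) ∷ map (map₁ (c ∷_)) (boundariesAfter c r)

  length-boundariesAfter : ∀ c r → length (boundariesAfter c r) ≡ runsFrom c r
  length-boundariesAfter c []      = refl
  length-boundariesAfter c (d ∷ r) with c ≟ d
  ... | yes _ = trans (length-map _ (boundariesAfter d r)) (length-boundariesAfter d r)
  ... | no _  = cong suc (trans (length-map _ (boundariesAfter d r)) (length-boundariesAfter d r))

  length-boundaries : ∀ c r → length (boundaries (c ∷ r)) ≡ suc (runs (c ∷ r))
  length-boundaries c r =
    cong suc (trans (length-map _ (boundariesAfter c r)) (length-boundariesAfter c r))

  ∈-boundariesAfter : ∀ c x y → RunBoundary (c ∷ x) y → (x , y) ∈ boundariesAfter c (x ++ y)
  ∈-boundariesAfter c []      []      _        = here refl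
  ∈-boundariesAfter c []      (d ∷ y) boundary with c ≟ d
  ... | yes refl = contradiction refl (boundary [] c refl)
  ... | no _     = here refl
  ∈-boundariesAfter c (d ∷ x) y       boundary
    with c ≟ d | ∈-boundariesAfter d x y (λ x₀ e eq → boundary (c ∷ x₀) e (cong (c ∷_) eq))
  ... | yes _ | x∈ = ∈-map⁺ _ x∈
  ... | no _  | x∈ = there (∈-map⁺ _ x∈)

  ∈-boundaries : ∀ {x y S} → x ++ y ≡ S → RunBoundary x y → (x , y) ∈ boundaries S
  ∈-boundaries {[]}    {[]}    refl _        = here refl
  ∈-boundaries {[]}    {_ ∷ _} refl _        = here refl
  ∈-boundaries {c ∷ x} {y}     refl boundary = there (∈-map⁺ _ (∈-boundariesAfter c x y boundary))

  LeftAnchored : List A → Split → Set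
  LeftAnchored w (x , y) = ∃[ a ] ∃[ v ] ∃[ z ] (w ≡ a ∷ a ∷ v × y ≡ a ∷ v ++ z)

  RightAnchored : List A → Split → Set
  RightAnchored w (x , y) = ∃[ v ] ∃[ b ] ∃[ p ] (w ≡ v ++ b ∷ b ∷ [] × x ≡ (p ++ v) ∷ʳ b)

  leftAnchored-comparable : ∀ {w w' x y} → LeftAnchored w (x , y) → LeftAnchored w' (x , y) →
                            w ⊑ w' ⊎ w' ⊑ w
  leftAnchored-comparable (a , v , z , refl , refl) (_ , v' , z' , refl , eq) with ∷-injective eq
  ... | refl , eq' with ++-prefixes-comparable v z v' z' eq'
  ... | inj₁ (d , refl) = inj₁ ([] , d , refl)
  ... | inj₂ (d , refl) = inj₂ ([] , d , refl)

  rightAnchored-comparable : ∀ {w w' x y} → RightAnchored w (x , y) → RightAnchored w' (x , y) →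
                             w ⊑ w' ⊎ w' ⊑ w
  rightAnchored-comparable (v , b , p , refl , refl) (v' , _ , p' , refl , eq)
    with ∷ʳ-injective (p ++ v) (p' ++ v') eq
  ... | eq' , refl with ++-suffixes-comparable p v p' v' eq'
  ... | inj₁ (d , refl) = inj₁ (⊑-++ˡ d v _)
  ... | inj₂ (d , refl) = inj₂ (⊑-++ˡ d v' _)

  module _ {S : List A} where

    absent : ∀ {w} → IsMAW w (mkT S) → ¬ w ⊑ S
    absent m = proj₁ m ∘ ⊑⇒OccursIn

    proper-factor-⊑ : ∀ {v w} → IsMAW w (mkT S) → v ≢ [] → v ⊑ w → v ≢ w → v ⊑ S
    proper-factor-⊑ m v≢[] v⊑w v≢w = OccursIn⇒⊑ v≢[] (proj₂ m _ v⊑w v≢w)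

    left-boundary : ∀ {a v x z} → IsMAW (a ∷ a ∷ v) (mkT S) → x ++ a ∷ v ++ z ≡ S →
                    RunBoundary x (a ∷ v ++ z)
    left-boundary m eq x₀ _ refl refl = absent m (x₀ , _ , trans (sym (∷ʳ-++ x₀ _ _)) eq)

    right-boundary : ∀ {v b x z} → IsMAW (v ++ b ∷ b ∷ []) (mkT S) → x ++ v ++ b ∷ z ≡ S →
                     RunBoundary ((x ++ v) ∷ʳ b) z
    right-boundary {z = []} m eq x₀ d _ ()
    right-boundary {v} {x = x} {z = c ∷ z} m eq x₀ _ x≡ refl with ∷ʳ-injectiveʳ (x ++ v) x₀ x≡
    ... | refl = absent m (x , z , trans (cong (x ++_) (++-assoc v _ z)) eq)

    left-anchor : ∀ {w a v} → IsMAW w (mkT S) → w ≡ a ∷ a ∷ v →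
                  Any (LeftAnchored w) (boundaries S)
    left-anchor {a = a} {v} m refl
      with proper-factor-⊑ m (λ ()) (a ∷ [] , [] , cong (λ u → a ∷ a ∷ u) (++-identityʳ v))
             (λ e → case ++-identityˡ-unique (a ∷ []) (∷-injectiveʳ e) of λ ())
    ... | x , z , eq = lose (∈-boundaries eq (left-boundary m eq)) (a , v , z , refl , refl)

    right-anchor : ∀ {w v b} → IsMAW w (mkT S) → w ≡ v ++ b ∷ b ∷ [] →
                   Any (RightAnchored w) (boundaries S)
    right-anchor {v = v} {b} m refl
      with proper-factor-⊑ m (λ e → case ++-conicalʳ v _ e of λ ()) ([] , b ∷ [] , ∷ʳ-++ v b _)
             (λ e → case ++-cancelˡ v _ _ e of λ ())
    ... | x , z , eq =
      lose (∈-boundaries at-split (right-boundary m at-b)) (v , b , x , refl , refl)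
      where
      at-b : x ++ v ++ b ∷ z ≡ S
      at-b = trans (cong (x ++_) (sym (∷ʳ-++ v b z))) eq
      at-split : (x ++ v) ∷ʳ b ++ z ≡ S
      at-split = trans (∷ʳ-++ (x ++ v) b z) (trans (++-assoc x v _) at-b)

  Anchored : List A → List A → Split ⊎ Split → Set
  Anchored S w s = IsMAW w (mkT S) × [ LeftAnchored w , RightAnchored w ]′ s

  anchored-disjoint : ∀ S {w w' s} → w ≢ w' → Anchored S w s → Anchored S w' s → ⊥
  anchored-disjoint _ {s = inj₁ (x , _)} w≢w' (m , l) (m' , l') =
    ⊑-comparable-MAWs m m' (leftAnchored-comparable {x = x} l l') w≢w'
  anchored-disjoint _ {s = inj₂ (_ , y)} w≢w' (m , r) (m' , r') =
    ⊑-comparable-MAWs m m' (rightAnchored-comparable {y = y} r r') w≢w'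

  anchors : List A → List (Split ⊎ Split)
  anchors S = map inj₁ (boundaries S) ++ map inj₂ (boundaries S)

  M5-anchored : ∀ {S w} → InM5 S w → Any (Anchored S w) (anchors S)
  M5-anchored (_ , []    , _ , _    , _ , _ , inj₁ ())
  M5-anchored (a , _ ∷ u , b , refl , m , _ , inj₁ refl) =
    ++⁺ˡ (map⁺ (Any.map (m ,_) (left-anchor m refl)))
  M5-anchored (a , u     , b , refl , m , _ , inj₂ last≡b) with last≡just⇒∷ʳ u last≡b
  ... | u₀ , refl =
    ++⁺ʳ _ (map⁺ (Any.map (m ,_) (right-anchor {v = a ∷ u₀} m (cong (a ∷_) (∷ʳ-++ u₀ b _)))))

  runsFrom-positive : ∀ c r → 1 ≤ runsFrom c r
  runsFrom-positive c []      = s≤s z≤n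
  runsFrom-positive c (d ∷ r) with c ≟ d
  ... | yes _ = runsFrom-positive d r
  ... | no _  = s≤s z≤n

  length-anchors : ∀ c r → length (anchors (c ∷ r)) ≤ 4 * runs (c ∷ r)
  length-anchors c r = begin
    length (anchors (c ∷ r))      ≡⟨ length-++ (map inj₁ B) ⟩
    length (map inj₁ B) + length (map inj₂ B)
                                  ≡⟨ cong₂ _+_ (length-map inj₁ B) (length-map inj₂ B) ⟩
    length B + length B           ≡⟨ cong₂ _+_ (length-boundaries c r) (length-boundaries c r) ⟩
    suc n + suc n                 ≤⟨ +-mono-≤ (+-monoˡ-≤ n 1≤n) (+-monoˡ-≤ n 1≤n) ⟩
    (n + n) + (n + n)             ≡⟨ [n+n]+[n+n]≡4*n n ⟩
    4 * n                         ∎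
    where
    open ≤-Reasoning
    B : List Split
    B = boundaries (c ∷ r)
    n : ℕ
    n = runs (c ∷ r)
    1≤n : 1 ≤ n
    1≤n = runsFrom-positive c r
    [n+n]+[n+n]≡4*n : ∀ n → (n + n) + (n + n) ≡ 4 * n
    [n+n]+[n+n]≡4*n = solve-∀

  length-M5≤4*runs : ∀ {S} → S ≢ [] → ∀ {ws} → Unique ws → All (InM5 S) ws →
                     length ws ≤ 4 * runs S
  length-M5≤4*runs {[]}         S≢[] _      _    = contradiction refl S≢[]
  length-M5≤4*runs {S@(c ∷ r)} _    unique inM5 = ≤-trans
    (pigeonhole {R = Anchored S} (λ {_ _ s} → anchored-disjoint S {s = s}) (anchors S) unique
                (All.map (M5-anchored {S}) inM5))
    (length-anchors c r)

lemma4 : ∃[ C ] ((A : Set) (_<_ : Rel A 0ℓ) (sto : IsStrictTotalOrder _≡_ _<_)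
    → (S : List A) → S ≢ []
    → (ws : List (List A))
    → Unique ws → All (Strings.InM5 sto S) ws
    → length ws ≤ C * Strings.runs sto S)
lemma4 = 4 , λ A _<_ sto S S≢[] ws → MinimalAbsentWords.length-M5≤4*runs sto S≢[]
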